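{- Let $b$ be an infinite binary sequence and let $w=\phi(b)$. Then for all $n\ge1$, \[p_w(n)=\begin{cases}p_b(k)+p_b(k+1)& n=2k\\ 2p_b(k+1)& n=2k+1\end{cases}\qquad q_w(n)=\begin{cases}q_b(k)+q_b(k+1)& n=2k\\ 2q_b(k+1)& n=2k+1.\end{cases}\]
   Context: $\phi$ is the letter-to-word substitution from binary sequences to words over $\{\mathsf{l}_\mathsf{u},\mathsf{u}_\mathsf{l},\mathsf{r}_\mathsf{u},\mathsf{u}_\mathsf{r}\}$ given by $\phi(0)=\mathsf{l}_\mathsf{u}\mathsf{u}_\mathsf{l}$ and $\phi(1)=\mathsf{r}_\mathsf{u}\mathsf{u}_\mathsf{r}$, applied letterwise. For an infinite word $x$, a factor is a contiguous subword, $p_x(n)$ is the number of distinct factors of length $n$, a factor is recurrent if it occurs infinitely often, and $q_x(n)$ is the number of distinct recurrent factors of length $n$. (Conventionally $p_b(0)=q_b(0)=1$, counting the empty word.) -}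

module Defs where

open import Data.Nat using (ℕ; zero; suc; _+_; _≤_)
open import Data.Bool using (Bool; true; false)
open import Data.Fin using (Fin; toℕ)
open import Data.Vec using (Vec; tabulate)
open import Data.List using (List; length)
open import Data.List.Relation.Unary.Unique.Propositional using (Unique)
open import Data.List.Membership.Propositional using (_∈_)
open import Data.Product using (Σ; ∃; _×_; _,_; proj₁; proj₂)
open import Function.Bundles using (_⇔_)
open import Relation.Binary.PropositionalEquality using (_≡_)

InfWord : Set → Set
InfWord A = ℕ → A

-- Binary letters: false = 0, true = 1.
-- The four-letter alphabet {l_u, u_l, r_u, u_r}.
data Letter : Set where
  lᵤ uₗ rᵤ uᵣ : Letter

φ : Bool → Letter × Letter
φ false = lᵤ , uₗ
φ true  = rᵤ , uᵣ

φ∞ : InfWord Bool → InfWord Letter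
φ∞ b zero          = proj₁ (φ (b 0))
φ∞ b (suc zero)    = proj₂ (φ (b 0))
φ∞ b (suc (suc n)) = φ∞ (λ i → b (suc i)) n

window : {A : Set} → InfWord A → ℕ → (n : ℕ) → Vec A n
window x i n = tabulate (λ j → x (i + toℕ j))

IsFactor : {A : Set} → InfWord A → {n : ℕ} → Vec A n → Set
IsFactor x {n} u = ∃ λ i → window x i n ≡ u

IsRecurrent : {A : Set} → InfWord A → {n : ℕ} → Vec A n → Set
IsRecurrent x {n} u = (N : ℕ) → ∃ λ i → N ≤ i × window x i n ≡ u

HasCount : {A : Set} {n : ℕ} → (Vec A n → Set) → ℕ → Set
HasCount {A} {n} P m =
  Σ (List (Vec A n)) λ L → Unique L × length L ≡ m × ((u : Vec A n) → (u ∈ L) ⇔ P u)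

FactorCount : {A : Set} → InfWord A → ℕ → ℕ → Set
FactorCount x n m = HasCount (λ (u : Vec _ n) → IsFactor x u) m

RecurrentCount : {A : Set} → InfWord A → ℕ → ℕ → Set
RecurrentCount x n m = HasCount (λ (u : Vec _ n) → IsRecurrent x u) m

-- φ(b) is read in blocks of two letters, so a window of φ(b) starting at an even position
-- 2i is determined by a window of b starting at i, and likewise for odd positions 2i + 1.
-- For each length n this gives two encodings of binary words by words of length n (one for
-- each parity of the starting position); both are injective, their images are disjoint
-- (they begin with a first resp. second letter of some φ(a)), and a factor of φ(b) is
-- recurrent iff its preimage is, since occurrences of the same word all have the same parity.
-- Counting the two images separately gives p_b(k) + p_b(k + 1) for n = 2k and 2 p_b(k + 1)
-- for n = 2k + 1, and the same for q.
module Submission where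

open import Defs
open import Data.Nat using (ℕ; zero; suc; _+_; _*_; _≤_; z≤n; s≤s)
open import Data.Nat.Properties using (≤-trans; +-identityʳ; +-suc; m≤n⇒m≤1+n)
open import Data.Bool using (Bool; true; false)
open import Data.Fin using (toℕ)
open import Data.Vec using (Vec; []; _∷_)
open import Data.Vec.Properties using (tabulate-cong; ∷-injective)
open import Data.List using (List; length; map; _++_)
open import Data.List.Properties using (length-++; length-map)
open import Data.List.Relation.Unary.Unique.Propositional using (Unique)
open import Data.List.Relation.Unary.Unique.Propositional.Properties using (map⁺; ++⁺)
open import Data.List.Membership.Propositional using (_∈_)
open import Data.List.Membership.Propositional.Properties
  using (∈-map⁺; ∈-map⁻; ∈-++⁺ˡ; ∈-++⁺ʳ; ∈-++⁻)
open import Data.Product using (Σ; ∃; _×_; _,_; proj₁; proj₂)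
open import Data.Sum using (_⊎_; inj₁; inj₂)
open import Data.Empty using (⊥-elim)
open import Function.Bundles using (_⇔_; mk⇔; Equivalence)
open import Function.Definitions using (Injective)
open import Relation.Nullary using (¬_)
open import Relation.Binary.PropositionalEquality
  using (_≡_; _≢_; refl; sym; trans; cong; cong₂; subst; module ≡-Reasoning)

Count : {X : Set} → (X → Set) → ℕ → Set
Count {X} P m = Σ (List X) λ L → Unique L × length L ≡ m × ((u : X) → (u ∈ L) ⇔ P u)

ImageOf : {X Y : Set} → (X → Y) → (X → Set) → Y → Set
ImageOf f P y = ∃ λ x → P x × f x ≡ y

Count-disjointImages : {A B C : Set} {P : A → Set} {Q : B → Set} {R : C → Set} {m₁ m₂ : ℕ}
  (f : A → C) (g : B → C) → Injective _≡_ _≡_ f → Injective _≡_ _≡_ g → (∀ a b → f a ≢ g b) →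
  Count P m₁ → Count Q m₂ → (∀ c → R c ⇔ (ImageOf f P c ⊎ ImageOf g Q c)) →
  Count R (m₁ + m₂)
Count-disjointImages {C = C} {R = R} f g f-inj g-inj f≢g (L₁ , !L₁ , ∣L₁∣ , L₁⇔P) (L₂ , !L₂ , ∣L₂∣ , L₂⇔Q) R⇔ =
  L , ++⁺ (map⁺ f-inj !L₁) (map⁺ g-inj !L₂) disjoint ,
  trans (length-++ (map f L₁))
        (cong₂ _+_ (trans (length-map f L₁) ∣L₁∣) (trans (length-map g L₂) ∣L₂∣)) ,
  λ c → mk⇔ (sound c) (complete c)
  where
  L : List C
  L = map f L₁ ++ map g L₂

  disjoint : ∀ {c} → ¬ (c ∈ map f L₁ × c ∈ map g L₂)
  disjoint (c∈fL₁ , c∈gL₂) with ∈-map⁻ f c∈fL₁ | ∈-map⁻ g c∈gL₂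
  ... | a , _ , refl | b , _ , fa≡gb = f≢g a b fa≡gb

  sound : ∀ c → c ∈ L → R c
  sound c c∈L with ∈-++⁻ (map f L₁) c∈L
  ... | inj₁ c∈fL₁ with ∈-map⁻ f c∈fL₁
  ...   | a , a∈L₁ , refl = Equivalence.from (R⇔ c) (inj₁ (a , Equivalence.to (L₁⇔P a) a∈L₁ , refl))
  sound c c∈L | inj₂ c∈gL₂ with ∈-map⁻ g c∈gL₂
  ...   | b , b∈L₂ , refl = Equivalence.from (R⇔ c) (inj₂ (b , Equivalence.to (L₂⇔Q b) b∈L₂ , refl))

  complete : ∀ c → R c → c ∈ L
  complete c Rc with Equivalence.to (R⇔ c) Rc
  ... | inj₁ (a , Pa , refl) = ∈-++⁺ˡ (∈-map⁺ f (Equivalence.from (L₁⇔P a) Pa))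
  ... | inj₂ (b , Qb , refl) = ∈-++⁺ʳ (map f L₁) (∈-map⁺ g (Equivalence.from (L₂⇔Q b) Qb))

window-suc : {A : Set} (x : InfWord A) (i n : ℕ) → window x i (suc n) ≡ x i ∷ window x (suc i) n
window-suc x i n = cong₂ _∷_ (cong x (+-identityʳ i)) (tabulate-cong (λ j → cong x (+-suc i (toℕ j))))

window-suc² : {A : Set} (x : InfWord A) (i n : ℕ) →
  window x i (suc (suc n)) ≡ x i ∷ x (suc i) ∷ window x (suc (suc i)) n
window-suc² x i n = trans (window-suc x i (suc n)) (cong (x i ∷_) (window-suc x (suc i) n))

double : ℕ → ℕ
double zero    = zero
double (suc n) = suc (suc (double n))

double≡2* : ∀ n → double n ≡ 2 * n
double≡2* zero    = refl
double≡2* (suc n) = cong suc (trans (cong suc (double≡2* n)) (sym (+-suc n (n + 0))))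

n≤double : ∀ n → n ≤ double n
n≤double zero    = z≤n
n≤double (suc n) = s≤s (m≤n⇒m≤1+n (n≤double n))

double-≤-suc-double : ∀ m n → double m ≤ suc (double n) → m ≤ n
double-≤-suc-double zero    n       _                 = z≤n
double-≤-suc-double (suc m) zero    (s≤s ())
double-≤-suc-double (suc m) (suc n) (s≤s (s≤s m≤n)) = s≤s (double-≤-suc-double m n m≤n)

double-or-suc-double : ∀ n → (∃ λ i → n ≡ double i) ⊎ (∃ λ i → n ≡ suc (double i))
double-or-suc-double zero = inj₁ (0 , refl)
double-or-suc-double (suc n) with double-or-suc-double n
... | inj₁ (i , refl) = inj₂ (i , refl)
... | inj₂ (i , refl) = inj₁ (suc i , refl)

φ₁ φ₂ : Bool → Letter
φ₁ a = proj₁ (φ a)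
φ₂ a = proj₂ (φ a)

φ₁-injective : Injective _≡_ _≡_ φ₁
φ₁-injective {false} {false} _ = refl
φ₁-injective {true}  {true}  _ = refl

φ₂-injective : Injective _≡_ _≡_ φ₂
φ₂-injective {false} {false} _ = refl
φ₂-injective {true}  {true}  _ = refl

φ₁≢φ₂ : ∀ a b → φ₁ a ≢ φ₂ b
φ₁≢φ₂ false false ()
φ₁≢φ₂ false true  ()
φ₁≢φ₂ true  false ()
φ₁≢φ₂ true  true  ()

φ∞-double : ∀ b i → φ∞ b (double i) ≡ φ₁ (b i)
φ∞-double b zero    = refl
φ∞-double b (suc i) = φ∞-double (λ j → b (suc j)) i

φ∞-suc-double : ∀ b i → φ∞ b (suc (double i)) ≡ φ₂ (b i)
φ∞-suc-double b zero    = refl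
φ∞-suc-double b (suc i) = φ∞-suc-double (λ j → b (suc j)) i

image : ∀ {k} → Vec Bool k → Vec Letter (double k)
image []      = []
image (a ∷ u) = φ₁ a ∷ φ₂ a ∷ image u

imageInit : ∀ {k} → Vec Bool (suc k) → Vec Letter (suc (double k))
imageInit {zero}  (a ∷ [])    = φ₁ a ∷ []
imageInit {suc k} (a ∷ a′ ∷ u) = φ₁ a ∷ φ₂ a ∷ imageInit (a′ ∷ u)

imageTail : ∀ {k} → Vec Bool (suc k) → Vec Letter (suc (double k))
imageTail (a ∷ u) = φ₂ a ∷ image u

-- φ(u) with its first and last letters removed.
innerImage : ∀ {k} → Vec Bool (suc (suc k)) → Vec Letter (double (suc k))
innerImage (a ∷ u) = φ₂ a ∷ imageInit u

image-injective : ∀ {k} → Injective _≡_ _≡_ (image {k})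
image-injective {x = []}    {[]}    _  = refl
image-injective {x = a ∷ u} {c ∷ v} eq with ∷-injective eq
... | φ₁a≡φ₁c , eq′ with φ₁-injective {a} {c} φ₁a≡φ₁c | ∷-injective eq′
...   | refl | _ , image-u≡image-v = cong (a ∷_) (image-injective image-u≡image-v)

imageInit-injective : ∀ {k} → Injective _≡_ _≡_ (imageInit {k})
imageInit-injective {zero}  {a ∷ []}     {c ∷ []}     eq with φ₁-injective {a} {c} (proj₁ (∷-injective eq))
... | refl = refl
imageInit-injective {suc k} {a ∷ a′ ∷ u} {c ∷ c′ ∷ v} eq with ∷-injective eq
... | φ₁a≡φ₁c , eq′ with φ₁-injective {a} {c} φ₁a≡φ₁c | imageInit-injective (proj₂ (∷-injective eq′))
...   | refl | refl = refl

imageTail-injective : ∀ {k} → Injective _≡_ _≡_ (imageTail {k})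
imageTail-injective {x = a ∷ u} {c ∷ v} eq with ∷-injective eq
... | φ₂a≡φ₂c , image-u≡image-v with φ₂-injective {a} {c} φ₂a≡φ₂c | image-injective image-u≡image-v
...   | refl | refl = refl

innerImage-injective : ∀ {k} → Injective _≡_ _≡_ (innerImage {k})
innerImage-injective {x = a ∷ u} {c ∷ v} eq with ∷-injective eq
... | φ₂a≡φ₂c , init-u≡init-v with φ₂-injective {a} {c} φ₂a≡φ₂c | imageInit-injective init-u≡init-v
...   | refl | refl = refl

image≢innerImage : ∀ {k} (u : Vec Bool (suc k)) v → image u ≢ innerImage v
image≢innerImage (a ∷ u) (c ∷ v) eq = φ₁≢φ₂ a c (proj₁ (∷-injective eq))

imageInit≢imageTail : ∀ {k} (u v : Vec Bool (suc k)) → imageInit u ≢ imageTail v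
imageInit≢imageTail {zero}  (a ∷ [])    (c ∷ v) eq = φ₁≢φ₂ a c (proj₁ (∷-injective eq))
imageInit≢imageTail {suc k} (a ∷ a′ ∷ u) (c ∷ v) eq = φ₁≢φ₂ a c (proj₁ (∷-injective eq))

module _ (b : InfWord Bool) where
  open ≡-Reasoning

  window-image : ∀ i k → window (φ∞ b) (double i) (double k) ≡ image (window b i k)
  window-image i zero    = refl
  window-image i (suc k) = begin
    window (φ∞ b) (double i) (double (suc k))
      ≡⟨ window-suc² (φ∞ b) (double i) (double k) ⟩
    φ∞ b (double i) ∷ φ∞ b (suc (double i)) ∷ window (φ∞ b) (double (suc i)) (double k)
      ≡⟨ cong₂ _∷_ (φ∞-double b i) (cong₂ _∷_ (φ∞-suc-double b i) (window-image (suc i) k)) ⟩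
    image (b i ∷ window b (suc i) k)
      ≡⟨ cong image (window-suc b i k) ⟨
    image (window b i (suc k)) ∎

  window-imageInit : ∀ i k → window (φ∞ b) (double i) (suc (double k)) ≡ imageInit (window b i (suc k))
  window-imageInit i zero = begin
    window (φ∞ b) (double i) 1  ≡⟨ window-suc (φ∞ b) (double i) 0 ⟩
    φ∞ b (double i) ∷ []         ≡⟨ cong (_∷ []) (φ∞-double b i) ⟩
    imageInit (b i ∷ [])         ≡⟨ cong imageInit (window-suc b i 0) ⟨
    imageInit (window b i 1)     ∎
  window-imageInit i (suc k) = begin
    window (φ∞ b) (double i) (suc (double (suc k)))
      ≡⟨ window-suc² (φ∞ b) (double i) (suc (double k)) ⟩
    φ∞ b (double i) ∷ φ∞ b (suc (double i)) ∷ window (φ∞ b) (double (suc i)) (suc (double k))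
      ≡⟨ cong₂ _∷_ (φ∞-double b i) (cong₂ _∷_ (φ∞-suc-double b i) (window-imageInit (suc i) k)) ⟩
    φ₁ (b i) ∷ φ₂ (b i) ∷ imageInit (window b (suc i) (suc k))
      ≡⟨ cong (λ u → φ₁ (b i) ∷ φ₂ (b i) ∷ imageInit u) (window-suc b (suc i) k) ⟩
    imageInit (b i ∷ b (suc i) ∷ window b (suc (suc i)) k)
      ≡⟨ cong imageInit (window-suc² b i k) ⟨
    imageInit (window b i (suc (suc k))) ∎

  window-imageTail : ∀ i k → window (φ∞ b) (suc (double i)) (suc (double k)) ≡ imageTail (window b i (suc k))
  window-imageTail i k = begin
    window (φ∞ b) (suc (double i)) (suc (double k))
      ≡⟨ window-suc (φ∞ b) (suc (double i)) (double k) ⟩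
    φ∞ b (suc (double i)) ∷ window (φ∞ b) (double (suc i)) (double k)
      ≡⟨ cong₂ _∷_ (φ∞-suc-double b i) (window-image (suc i) k) ⟩
    imageTail (b i ∷ window b (suc i) k)
      ≡⟨ cong imageTail (window-suc b i k) ⟨
    imageTail (window b i (suc k)) ∎

  window-innerImage : ∀ i k → window (φ∞ b) (suc (double i)) (double (suc k)) ≡ innerImage (window b i (suc (suc k)))
  window-innerImage i k = begin
    window (φ∞ b) (suc (double i)) (double (suc k))
      ≡⟨ window-suc (φ∞ b) (suc (double i)) (suc (double k)) ⟩
    φ∞ b (suc (double i)) ∷ window (φ∞ b) (double (suc i)) (suc (double k))
      ≡⟨ cong₂ _∷_ (φ∞-suc-double b i) (window-imageInit (suc i) k) ⟩
    innerImage (b i ∷ window b (suc i) (suc k))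
      ≡⟨ cong innerImage (window-suc b i (suc k)) ⟨
    innerImage (window b i (suc (suc k))) ∎

module ParityDecomposition {A B : Set} (w : InfWord A) (x : InfWord B) {n k₁ k₂ : ℕ}
  (f : Vec B k₁ → Vec A n) (g : Vec B k₂ → Vec A n)
  (window-even : ∀ i → window w (double i) n ≡ f (window x i k₁))
  (window-odd  : ∀ i → window w (suc (double i)) n ≡ g (window x i k₂))
  (f-inj : Injective _≡_ _≡_ f) (g-inj : Injective _≡_ _≡_ g) (f≢g : ∀ a b → f a ≢ g b) where

  isFactor⇔ : ∀ u → IsFactor w u ⇔ (ImageOf f (IsFactor x) u ⊎ ImageOf g (IsFactor x) u)
  isFactor⇔ u = mk⇔ to from
    where
    to : IsFactor w u → ImageOf f (IsFactor x) u ⊎ ImageOf g (IsFactor x) u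
    to (j , occ) with double-or-suc-double j
    ... | inj₁ (i , refl) = inj₁ (window x i k₁ , (i , refl) , trans (sym (window-even i)) occ)
    ... | inj₂ (i , refl) = inj₂ (window x i k₂ , (i , refl) , trans (sym (window-odd i)) occ)
    from : ImageOf f (IsFactor x) u ⊎ ImageOf g (IsFactor x) u → IsFactor w u
    from (inj₁ (_ , (i , refl) , refl)) = double i , window-even i
    from (inj₂ (_ , (i , refl) , refl)) = suc (double i) , window-odd i

  evenOccurrence : ∀ {u} i j → window w (double i) n ≡ u → window w j n ≡ u →
                   ∃ λ i′ → j ≡ double i′ × window x i′ k₁ ≡ window x i k₁
  evenOccurrence i j occ occ′ with double-or-suc-double j
  ... | inj₁ (i′ , refl) = i′ , refl , f-inj (trans (sym (window-even i′)) (trans occ′ (trans (sym occ) (window-even i))))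
  ... | inj₂ (i′ , refl) = ⊥-elim (f≢g _ _ (trans (sym (window-even i)) (trans occ (trans (sym occ′) (window-odd i′)))))

  oddOccurrence : ∀ {u} i j → window w (suc (double i)) n ≡ u → window w j n ≡ u →
                  ∃ λ i′ → j ≡ suc (double i′) × window x i′ k₂ ≡ window x i k₂
  oddOccurrence i j occ occ′ with double-or-suc-double j
  ... | inj₁ (i′ , refl) = ⊥-elim (f≢g _ _ (trans (sym (window-even i′)) (trans occ′ (trans (sym occ) (window-odd i)))))
  ... | inj₂ (i′ , refl) = i′ , refl , g-inj (trans (sym (window-odd i′)) (trans occ′ (trans (sym occ) (window-odd i))))

  isRecurrent⇔ : ∀ u → IsRecurrent w u ⇔ (ImageOf f (IsRecurrent x) u ⊎ ImageOf g (IsRecurrent x) u)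
  isRecurrent⇔ u = mk⇔ to from
    where
    to : IsRecurrent w u → ImageOf f (IsRecurrent x) u ⊎ ImageOf g (IsRecurrent x) u
    to rec with rec 0
    ... | j , _ , occ with double-or-suc-double j
    ...   | inj₁ (i , refl) = inj₁ (window x i k₁ , recurrent , trans (sym (window-even i)) occ)
      where
      recurrent : IsRecurrent x (window x i k₁)
      recurrent N with rec (double N)
      ... | j′ , N≤j′ , occ′ with evenOccurrence i j′ occ occ′
      ...   | i′ , refl , same = i′ , double-≤-suc-double N i′ (m≤n⇒m≤1+n N≤j′) , same
    ...   | inj₂ (i , refl) = inj₂ (window x i k₂ , recurrent , trans (sym (window-odd i)) occ)
      where
      recurrent : IsRecurrent x (window x i k₂)
      recurrent N with rec (double N)
      ... | j′ , N≤j′ , occ′ with oddOccurrence i j′ occ occ′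
      ...   | i′ , refl , same = i′ , double-≤-suc-double N i′ N≤j′ , same
    from : ImageOf f (IsRecurrent x) u ⊎ ImageOf g (IsRecurrent x) u → IsRecurrent w u
    from (inj₁ (_ , rec , refl)) N with rec N
    ... | i , N≤i , refl = double i , ≤-trans N≤i (n≤double i) , window-even i
    from (inj₂ (_ , rec , refl)) N with rec N
    ... | i , N≤i , refl = suc (double i) , ≤-trans N≤i (m≤n⇒m≤1+n (n≤double i)) , window-odd i

  factorCount : ∀ {m₁ m₂} → FactorCount x k₁ m₁ → FactorCount x k₂ m₂ → FactorCount w n (m₁ + m₂)
  factorCount c₁ c₂ = Count-disjointImages f g f-inj g-inj f≢g c₁ c₂ isFactor⇔

  recurrentCount : ∀ {m₁ m₂} → RecurrentCount x k₁ m₁ → RecurrentCount x k₂ m₂ → RecurrentCount w n (m₁ + m₂)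
  recurrentCount c₁ c₂ = Count-disjointImages f g f-inj g-inj f≢g c₁ c₂ isRecurrent⇔

module EvenLength (b : InfWord Bool) (k : ℕ) = ParityDecomposition (φ∞ b) b image innerImage
  (λ i → window-image b i (suc k)) (λ i → window-innerImage b i k)
  image-injective innerImage-injective image≢innerImage

module OddLength (b : InfWord Bool) (k : ℕ) = ParityDecomposition (φ∞ b) b imageInit imageTail
  (λ i → window-imageInit b i k) (λ i → window-imageTail b i k)
  imageInit-injective imageTail-injective imageInit≢imageTail

atPositiveEvenLength : (P : ℕ → ℕ → Set) → ∀ {n k} → 1 ≤ n → n ≡ 2 * k →
                       (∀ k → P (suc k) (double (suc k))) → P k n
-- The missing case k = 0 is absurd since 1 ≤ n = 0.
atPositiveEvenLength P {k = suc k} _ refl h = subst (P (suc k)) (double≡2* (suc k)) (h k)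

atOddLength : (P : ℕ → ℕ → Set) → ∀ {n k} → n ≡ suc (2 * k) → (∀ k → P k (suc (double k))) → P k n
atOddLength P {k = k} refl h = subst (P k) (cong suc (double≡2* k)) (h k)

m+m≡2*m : ∀ m → m + m ≡ 2 * m
m+m≡2*m m = cong (m +_) (sym (+-identityʳ m))

proposition4p3 : (b : InfWord Bool) → (n k : ℕ) → 1 ≤ n →
    ((n ≡ 2 * k → (m₁ m₂ : ℕ) → FactorCount b k m₁ → FactorCount b (suc k) m₂ → FactorCount (φ∞ b) n (m₁ + m₂))
    × (n ≡ suc (2 * k) → (m : ℕ) → FactorCount b (suc k) m → FactorCount (φ∞ b) n (2 * m)))
    × ((n ≡ 2 * k → (m₁ m₂ : ℕ) → RecurrentCount b k m₁ → RecurrentCount b (suc k) m₂ → RecurrentCount (φ∞ b) n (m₁ + m₂))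
    × (n ≡ suc (2 * k) → (m : ℕ) → RecurrentCount b (suc k) m → RecurrentCount (φ∞ b) n (2 * m)))
proposition4p3 b n k 1≤n =
  ( (λ n≡2k → atPositiveEvenLength (EvenCase FactorCount) 1≤n n≡2k (λ k′ _ _ → EvenLength.factorCount b k′))
  , (λ n≡2k+1 → atOddLength (OddCase FactorCount) n≡2k+1
       (λ k′ m c → subst (FactorCount (φ∞ b) _) (m+m≡2*m m) (OddLength.factorCount b k′ c c))) )
  , ( (λ n≡2k → atPositiveEvenLength (EvenCase RecurrentCount) 1≤n n≡2k (λ k′ _ _ → EvenLength.recurrentCount b k′))
  , (λ n≡2k+1 → atOddLength (OddCase RecurrentCount) n≡2k+1
       (λ k′ m c → subst (RecurrentCount (φ∞ b) _) (m+m≡2*m m) (OddLength.recurrentCount b k′ c c))) )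
  where
  EvenCase OddCase : (∀ {A : Set} → InfWord A → ℕ → ℕ → Set) → ℕ → ℕ → Set
  EvenCase Counts k n = ∀ m₁ m₂ → Counts b k m₁ → Counts b (suc k) m₂ → Counts (φ∞ b) n (m₁ + m₂)
  OddCase  Counts k n = ∀ m → Counts b (suc k) m → Counts (φ∞ b) n (2 * m)
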